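{- For every $\varepsilon>0$ and $n\in\mathbb{N}$ there exists $N\in\mathbb{N}$ such that the following holds. For every $N$-partitioned hypergraph $H$ there exist reals $\ell,t,r$ and an $n$-partitioned induced subhypergraph $H'$ of $H$ (with vertex parts $V'_{ij}$) such that for all $1\le i<j<k\le n$: $\ell|V'_{ij}|\le|\{v\in V'_{ij}: d_{ij\to k}(v)\ge\varepsilon\}|\le(\ell+\varepsilon)|V'_{ij}|$, $t|V'_{ik}|\le|\{v\in V'_{ik}: d_{ik\to j}(v)\ge\varepsilon\}|\le(t+\varepsilon)|V'_{ik}|$, and $r|V'_{jk}|\le|\{v\in V'_{jk}: d_{jk\to i}(v)\ge\varepsilon\}|\le(r+\varepsilon)|V'_{jk}|$, where the degrees are computed in $H'$.
   Context: An $n$-partitioned hypergraph is a $3$-uniform hypergraph whose vertex set is partitioned into (finite, nonempty) sets $V_{ij}$, $1\le i<j\le n$, such that every edge consists of one vertex from $V_{ij}$, one from $V_{ik}$ and one from $V_{jk}$ for some $1\le i<j<k\le n$. The $(i,j,k)$-triad is the set of edges with one vertex in each of $V_{ij},V_{ik},V_{jk}$. For $I=\{a_1<\cdots<a_m\}\subseteq[n]$, the subhypergraph induced by $I$ is the $m$-partitioned hypergraph with parts $V'_{ij}=V_{a_ia_j}$ containing all edges of $H$ whose vertices lie in these parts; these are the $m$-partitioned induced subhypergraphs. For $1\le i<j<k\le n$: $d_{ij\to k}(v)$ for $v\in V_{ij}$ is the number of edges of the $(i,j,k)$-triad containing $v$ divided by $|V_{ik}||V_{jk}|$; $d_{ik\to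 j}(v)$ for $v\in V_{ik}$ is that number divided by $|V_{ij}||V_{jk}|$; $d_{jk\to i}(v)$ for $v\in V_{jk}$ is that number divided by $|V_{ij}||V_{ik}|$.
   Formalization: The parameter ε ranges over the positive rationals, and the reals ℓ, t, r are replaced by rationals. -}

module Defs where

open import Data.Nat as ℕ using (ℕ; zero; suc; NonZero)
open import Data.Nat.Properties using (m*n≢0)
open import Data.Fin as Fin using (Fin; zero; suc)
open import Data.Bool using (Bool; true; false; if_then_else_)
open import Data.Integer using (+_)
open import Data.Product using (_×_)
open import Data.Rational as ℚ using (ℚ; _/_)
open import Data.Rational.Properties using (_≤?_)
open import Relation.Nullary using (Dec; yes; no)

sumFin : (n : ℕ) → (Fin n → ℕ) → ℕ
sumFin zero    f = 0
sumFin (suc n) f = f zero ℕ.+ sumFin n (λ x → f (suc x))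

countFin : (n : ℕ) → {P : Fin n → Set} → ((x : Fin n) → Dec (P x)) → ℕ
countFin n P? = sumFin n (λ x → indicator (P? x))
  where
  indicator : ∀ {A : Set} → Dec A → ℕ
  indicator (yes _) = 1
  indicator (no _)  = 0

ℕtoℚ : ℕ → ℚ
ℕtoℚ m = + m / 1

-- Parts V_ij (i < j) are Fin (size i j);
-- edges of the (i,j,k)-triad (i < j < k) are given by the Boolean
-- predicate edge i j k on V_ij × V_ik × V_jk.  Values of size/edge at
-- index tuples that are not strictly increasing are never used.
record PHG (N : ℕ) : Set where
  field
    size     : Fin N → Fin N → ℕ
    nonempty : (i j : Fin N) → NonZero (size i j)
    edge     : (i j k : Fin N) →
               Fin (size i j) → Fin (size i k) → Fin (size j k) → Bool
open PHG public

StrictlyIncreasing : ∀ {n N} → (Fin n → Fin N) → Set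
StrictlyIncreasing a = ∀ i j → i Fin.< j → a i Fin.< a j

induced : ∀ {n N} → PHG N → (Fin n → Fin N) → PHG n
induced H a = record
  { size     = λ i j → size H (a i) (a j)
  ; nonempty = λ i j → nonempty H (a i) (a j)
  ; edge     = λ i j k → edge H (a i) (a j) (a k)
  }

module _ {N : ℕ} (H : PHG N) (i j k : Fin N) where
  private
    E = edge H i j k
    sij = size H i j
    sik = size H i k
    sjk = size H j k
    b2n : Bool → ℕ
    b2n true  = 1
    b2n false = 0
    instance
      nzij : NonZero sij
      nzij = nonempty H i j
      nzik : NonZero sik
      nzik = nonempty H i k
      nzjk : NonZero sjk
      nzjk = nonempty H j k

  degij : Fin sij → ℕ
  degij v = sumFin sik (λ x → sumFin sjk (λ y → b2n (E v x y)))

  degik : Fin sik → ℕ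
  degik v = sumFin sij (λ x → sumFin sjk (λ y → b2n (E x v y)))

  degjk : Fin sjk → ℕ
  degjk v = sumFin sij (λ x → sumFin sik (λ y → b2n (E x y v)))

  d-ij→k : Fin sij → ℚ
  d-ij→k v = (+ degij v / (sik ℕ.* sjk)) {{m*n≢0 sik sjk}}

  d-ik→j : Fin sik → ℚ
  d-ik→j v = (+ degik v / (sij ℕ.* sjk)) {{m*n≢0 sij sjk}}

  d-jk→i : Fin sjk → ℚ
  d-jk→i v = (+ degjk v / (sij ℕ.* sik)) {{m*n≢0 sij sik}}

  highij : ℚ → ℕ
  highij ε = countFin sij (λ v → ε ≤? d-ij→k v)

  highik : ℚ → ℕ
  highik ε = countFin sik (λ v → ε ≤? d-ik→j v)

  highjk : ℚ → ℕ
  highjk ε = countFin sjk (λ v → ε ≤? d-jk→i v)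

Sandwich : ℚ → ℚ → ℕ → ℕ → Set
Sandwich ℓ ε c V = (ℓ ℚ.* ℕtoℚ V ℚ.≤ ℕtoℚ c) × (ℕtoℚ c ℚ.≤ (ℓ ℚ.+ ε) ℚ.* ℕtoℚ V)

{-# OPTIONS --safe #-}
-- Choose m with (m + 1)ε ≥ 1 and give each side V_xy of a triad x < y < z a level q ≤ m: the
-- largest q with qε|V_xy| at most the number c of vertices of degree at least ε, so that
-- qε|V_xy| ≤ c ≤ (q + 1)ε|V_xy|.  Colouring every triple x < y < z by the levels of its three
-- sides uses (m + 1)³ colours, and Ramsey's theorem for triples gives n indices on which this
-- colour is constant; its three levels are ℓ, t and r.  Ramsey's theorem for r-sets is proved by
-- stepping up: an (r + 1)-colouring has a long increasing sequence along which the colour of a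
-- tuple depends only on its least element, and the pigeonhole principle finishes.
module Submission where

open import Defs
open import Data.Nat using (ℕ)
open import Data.Fin using (Fin; _<_)
open import Data.Product using (Σ; _×_)
open import Data.Rational using (ℚ; 0ℚ) renaming (_<_ to _<ℚ_)

open import Data.Fin as Fin using (zero; suc; punchOut; toℕ; fromℕ<; funToFin; finToFun)
open import Data.Fin.Properties using (_≟_; punchIn-punchOut; toℕ-fromℕ<; finToFun-funToFin)
import Data.Fin.Properties as Fin
open import Data.Integer as ℤ using (+_; +[1+_]; -[1+_])
import Data.Integer.Properties as ℤ
open import Data.Integer.Tactic.RingSolver using (solve-∀)
open import Data.Nat as ℕ using (zero; suc; _+_; _*_; _^_; _≤_; z≤n; s≤s)
open import Data.Nat.Coprimality using (Coprime)
open import Data.Nat.Properties using (≤-refl; ≤-reflexive; ≤-trans; +-suc; m≤n⇒m≤1+n; m≤m*n)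
open import Data.Product using (_,_; proj₁; proj₂; ∃-syntax; Σ-syntax)
open import Data.Rational as ℚ using (mkℚ; 1ℚ; toℚᵘ)
import Data.Rational.Properties as ℚ
open import Algebra.Definitions.RawMonoid ℚ.+-0-rawMonoid using () renaming (_×_ to _·_)
open import Data.Rational.Unnormalised as ℚᵘ using (mkℚᵘ; *≡*; *≤*) renaming (_≃_ to _≃ᵘ_)
import Data.Rational.Unnormalised.Properties as ℚᵘ
open import Data.Sum using (_⊎_; inj₁; inj₂)
import Data.Sum as Sum
open import Data.Vec using (Vec; []; _∷_; map; head)
open import Data.Vec.Properties using (map-∘)
open import Data.Vec.Relation.Unary.All as All using (All; []; _∷_)
import Data.Vec.Relation.Unary.All.Properties as All
open import Data.Vec.Relation.Unary.AllPairs as AllPairs using (AllPairs; []; _∷_)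
import Data.Vec.Relation.Unary.AllPairs.Properties as AllPairs
open import Function using (_∘_; id)
open import Relation.Binary.Core using (Rel)
open import Relation.Binary.PropositionalEquality
open import Relation.Nullary using (¬_; yes; no)
open import Relation.Unary using (Decidable; ∁)

module _ {n N : ℕ} where

  StrictlyIncreasing-lift : {f : Fin n → Fin N} → StrictlyIncreasing f →
                            StrictlyIncreasing (Fin.lift 1 f)
  StrictlyIncreasing-lift f↑ zero    (suc j) _   = ℕ.z<s
  StrictlyIncreasing-lift f↑ (suc i) (suc j) i<j = ℕ.s<s (f↑ i j (ℕ.s<s⁻¹ i<j))

  StrictlyIncreasing-suc : {f : Fin n → Fin N} → StrictlyIncreasing f → StrictlyIncreasing (suc ∘ f)
  StrictlyIncreasing-suc f↑ i j i<j = ℕ.s<s (f↑ i j i<j)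

StrictlyIncreasing-∘ : ∀ {l m n} {f : Fin m → Fin n} {g : Fin l → Fin m} →
                       StrictlyIncreasing f → StrictlyIncreasing g → StrictlyIncreasing (f ∘ g)
StrictlyIncreasing-∘ f↑ g↑ i j i<j = f↑ _ _ (g↑ i j i<j)

record IncreasingIn {N : ℕ} (P : Fin N → Set) (n : ℕ) : Set where
  constructor increasingIn
  field
    embedding  : Fin n → Fin N
    increasing : StrictlyIncreasing embedding
    satisfies  : ∀ i → P (embedding i)

module _ {N : ℕ} {P : Fin (suc N) → Set} {n : ℕ} where

  IncreasingIn-cons : P zero → IncreasingIn (P ∘ suc) n → IncreasingIn P (suc n)
  IncreasingIn-cons P0 (increasingIn b b↑ Pb) =
    increasingIn (Fin.lift 1 b) (StrictlyIncreasing-lift b↑) λ { zero → P0 ; (suc i) → Pb i }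

  IncreasingIn-suc : IncreasingIn (P ∘ suc) n → IncreasingIn P n
  IncreasingIn-suc (increasingIn b b↑ Pb) = increasingIn (suc ∘ b) (StrictlyIncreasing-suc b↑) Pb

IncreasingIn-empty : ∀ {N} {P : Fin N → Set} → IncreasingIn P 0
IncreasingIn-empty = increasingIn (λ ()) (λ ()) (λ ())

pigeonhole₂ : ∀ {N} {P : Fin N → Set} → Decidable P →
              ∀ n m → n + m ≤ N → IncreasingIn P n ⊎ IncreasingIn (∁ P) m
pigeonhole₂ P? zero    m       _ = inj₁ IncreasingIn-empty
pigeonhole₂ P? (suc n) zero    _ = inj₂ IncreasingIn-empty
pigeonhole₂ {suc N} P? (suc n) (suc m) (s≤s n+1+m≤N) with P? zero
... | yes P0 = Sum.map (IncreasingIn-cons P0) IncreasingIn-suc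
                 (pigeonhole₂ (P? ∘ suc) n (suc m) n+1+m≤N)
... | no ¬P0 = Sum.map IncreasingIn-suc (IncreasingIn-cons ¬P0)
                 (pigeonhole₂ (P? ∘ suc) (suc n) m
                   (≤-trans (≤-reflexive (sym (+-suc n m))) n+1+m≤N))

pigeonholeBound : ℕ → ℕ → ℕ
pigeonholeBound K n = suc (K * n)

pigeonhole : ∀ K n (f : Fin (pigeonholeBound K n) → Fin K) →
             Σ[ col ∈ Fin K ] IncreasingIn (λ x → f x ≡ col) n
pigeonhole zero    n f with () ← f zero
pigeonhole (suc K) n f
  with pigeonhole₂ (λ x → f x ≟ zero) n (pigeonholeBound K n) (≤-reflexive (+-suc n (K * n)))
... | inj₁ zeros = zero , zeros
... | inj₂ (increasingIn b b↑ fb≢0)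
  with pigeonhole K n (λ x → punchOut {i = zero} (fb≢0 x ∘ sym))
...   | col , increasingIn b′ b′↑ eq =
  suc col , increasingIn (b ∘ b′) (StrictlyIncreasing-∘ b↑ b′↑)
                         (λ i → trans (sym (punchIn-punchOut {i = zero} _)) (cong suc (eq i)))

AllPairs-map⁻ : ∀ {a b ℓ} {A : Set a} {B : Set b} {R : Rel A ℓ} {f : B → A} {r} {xs : Vec B r} →
                AllPairs R (map f xs) → AllPairs (λ x y → R (f x) (f y)) xs
AllPairs-map⁻ {xs = []}    []         = []
AllPairs-map⁻ {xs = x ∷ xs} (px ∷ pxs) = All.map⁻ px ∷ AllPairs-map⁻ pxs

AllPairs<-map : ∀ {r n N} {b : Fin n → Fin N} → StrictlyIncreasing b →
                {s : Vec (Fin n) r} → AllPairs _<_ s → AllPairs _<_ (map b s)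
AllPairs<-map b↑ = AllPairs.map⁺ ∘ AllPairs.map (b↑ _ _)

AllPairs<-map-suc⁻ : ∀ {r N} {s : Vec (Fin N) r} → AllPairs _<_ (map suc s) → AllPairs _<_ s
AllPairs<-map-suc⁻ = AllPairs.map ℕ.s<s⁻¹ ∘ AllPairs-map⁻

All>⇒map-suc : ∀ {r N} {x : Fin (suc N)} (s : Vec (Fin (suc N)) r) → All (x <_) s →
               ∃[ t ] s ≡ map suc t
All>⇒map-suc []          []         = [] , refl
All>⇒map-suc (suc y ∷ s) (_ ∷ x<s) with t , refl ← All>⇒map-suc s x<s = y ∷ t , refl

Homogeneous : ∀ {r n N K} → (Vec (Fin N) r → Fin K) → (Fin n → Fin N) → Fin K → Set
Homogeneous c b col = ∀ s → AllPairs _<_ s → c (map b s) ≡ col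

HomogeneousSet : ∀ {r N K} → (Vec (Fin N) r → Fin K) → ℕ → Set
HomogeneousSet {N = N} {K} c n =
  Σ[ b ∈ (Fin n → Fin N) ] StrictlyIncreasing b × Σ[ col ∈ Fin K ] Homogeneous c b col

EndHomogeneousSet : ∀ {r N K} → (Vec (Fin N) (suc r) → Fin K) → ℕ → Set
EndHomogeneousSet {N = N} {K} c L =
  Σ[ e ∈ (Fin L → Fin N) ] StrictlyIncreasing e ×
  Σ[ g ∈ (Fin L → Fin K) ] (∀ s → AllPairs _<_ s → c (map e s) ≡ g (head s))

endHomogeneousBound : (ℕ → ℕ) → ℕ → ℕ
endHomogeneousBound f zero    = zero
endHomogeneousBound f (suc L) = suc (f (endHomogeneousBound f L))

module SteppingUp {r K : ℕ} {f : ℕ → ℕ}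
                  (ramsey-r : ∀ n (c : Vec (Fin (f n)) r → Fin K) → HomogeneousSet c n) where

  endHomogeneous : ∀ L (c : Vec (Fin (endHomogeneousBound f L)) (suc r) → Fin K) →
                   EndHomogeneousSet c L
  endHomogeneous zero    c = (λ ()) , (λ ()) , (λ ()) , λ { (() ∷ _) _ }
  endHomogeneous (suc L) c
    with b , b↑ , col , b-hom ← ramsey-r _ (λ s → c (zero ∷ map suc s))
    with e , e↑ , g , e-hom ← endHomogeneous L (λ s → c (map suc (map b s)))
    = Fin.lift 1 (b ∘ e) , StrictlyIncreasing-lift (StrictlyIncreasing-∘ b↑ e↑) , g′ , hom
    where
    g′ : Fin (suc L) → Fin K
    g′ zero    = col
    g′ (suc i) = g i

    map-lift-suc : ∀ {r′} (t : Vec (Fin L) r′) →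
                   map (Fin.lift 1 (b ∘ e)) (map suc t) ≡ map suc (map b (map e t))
    map-lift-suc []      = refl
    map-lift-suc (x ∷ t) = cong (suc (b (e x)) ∷_) (map-lift-suc t)

    hom : ∀ s → AllPairs _<_ s → c (map (Fin.lift 1 (b ∘ e)) s) ≡ g′ (head s)
    hom (zero ∷ s) (0<s ∷ s↑) with t , refl ← All>⇒map-suc s 0<s =
      trans (cong (λ u → c (zero ∷ u)) (map-lift-suc t))
            (b-hom (map e t) (AllPairs<-map e↑ (AllPairs<-map-suc⁻ s↑)))
    hom (suc y ∷ s) (y<s ∷ s↑) with t , refl ← All>⇒map-suc s y<s =
      trans (cong (λ u → c (suc (b (e y)) ∷ u)) (map-lift-suc t))
            (e-hom (y ∷ t) (AllPairs<-map-suc⁻ (y<s ∷ s↑)))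

  ramsey-suc : ∀ n (c : Vec (Fin (endHomogeneousBound f (pigeonholeBound K n))) (suc r) → Fin K) →
               HomogeneousSet c n
  ramsey-suc n c
    with e , e↑ , g , e-hom ← endHomogeneous (pigeonholeBound K n) c
    with col , increasingIn b b↑ gb≡col ← pigeonhole K n g
    = e ∘ b , StrictlyIncreasing-∘ e↑ b↑ , col , hom
    where
    hom : Homogeneous c (e ∘ b) col
    hom (x ∷ s) s↑ = begin
      c (map (e ∘ b) (x ∷ s))   ≡⟨ cong c (map-∘ e b (x ∷ s)) ⟩
      c (map e (map b (x ∷ s))) ≡⟨ e-hom (map b (x ∷ s)) (AllPairs<-map b↑ s↑) ⟩
      g (b x)                   ≡⟨ gb≡col x ⟩
      col                       ∎
      where open ≡-Reasoning

ramseyNumber : ℕ → ℕ → ℕ → ℕ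
ramseyNumber zero    K n = n
ramseyNumber (suc r) K n = endHomogeneousBound (ramseyNumber r K) (pigeonholeBound K n)

ramsey : ∀ r K n (c : Vec (Fin (ramseyNumber r K n)) r → Fin K) → HomogeneousSet c n
ramsey zero    K n c = id , (λ _ _ i<j → i<j) , c [] , λ { [] [] → refl }
ramsey (suc r) K   = SteppingUp.ramsey-suc (ramsey r K)

+-mkℚᵘ-sameDenominator : ∀ x y d-1 → mkℚᵘ x d-1 ℚᵘ.+ mkℚᵘ y d-1 ≃ᵘ mkℚᵘ (x ℤ.+ y) d-1
+-mkℚᵘ-sameDenominator x y d-1 = *≡* (begin
  (x ℤ.* d ℤ.+ y ℤ.* d) ℤ.* d       ≡⟨ distrib x y d ⟩
  (x ℤ.+ y) ℤ.* (d ℤ.* d)           ≡⟨ cong ((x ℤ.+ y) ℤ.*_) (ℤ.pos-* (suc d-1) (suc d-1)) ⟨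
  (x ℤ.+ y) ℤ.* + (suc d-1 * suc d-1) ∎)
  where
  open ≡-Reasoning
  d = + suc d-1
  distrib : ∀ x y d → (x ℤ.* d ℤ.+ y ℤ.* d) ℤ.* d ≡ (x ℤ.+ y) ℤ.* (d ℤ.* d)
  distrib = solve-∀

toℚᵘ-·-mkℚ : ∀ q a d-1 .(coprime : Coprime a (suc d-1)) →
        toℚᵘ (q · mkℚ (+ a) d-1 coprime) ≃ᵘ mkℚᵘ (+ (q * a)) d-1
toℚᵘ-·-mkℚ zero    a d-1 coprime = *≡* refl
toℚᵘ-·-mkℚ (suc q) a d-1 coprime = begin-equality
  toℚᵘ (ε ℚ.+ q · ε)                        ≃⟨ ℚ.toℚᵘ-homo-+ ε (q · ε) ⟩
  mkℚᵘ (+ a) d-1 ℚᵘ.+ toℚᵘ (q · ε)          ≃⟨ ℚᵘ.+-congʳ (mkℚᵘ (+ a) d-1) (toℚᵘ-·-mkℚ q a d-1 coprime) ⟩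
  mkℚᵘ (+ a) d-1 ℚᵘ.+ mkℚᵘ (+ (q * a)) d-1  ≃⟨ +-mkℚᵘ-sameDenominator (+ a) (+ (q * a)) d-1 ⟩
  mkℚᵘ (+ a ℤ.+ + (q * a)) d-1              ≡⟨ cong (λ n → mkℚᵘ n d-1) (ℤ.pos-+ a (q * a)) ⟨
  mkℚᵘ (+ (a + q * a)) d-1                  ∎
  where
  open ℚᵘ.≤-Reasoning
  ε = mkℚ (+ a) d-1 coprime

archimedean : ∀ ε → 0ℚ <ℚ ε → ∃[ m ] 1ℚ ℚ.≤ suc m · ε
archimedean (mkℚ (+ zero)   d-1 _) (ℚ.*<* (ℤ.+<+ ()))
archimedean (mkℚ -[1+ _ ]   d-1 _) (ℚ.*<* ())
archimedean (mkℚ +[1+ a ] d-1 coprime) _ = d-1 , ℚ.toℚᵘ-cancel-≤ (begin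
  ℚᵘ.1ℚᵘ                            ≤⟨ *≤* 1*d≤d*a*1 ⟩
  mkℚᵘ (+ (suc d-1 * suc a)) d-1    ≃⟨ toℚᵘ-·-mkℚ (suc d-1) (suc a) d-1 coprime ⟨
  toℚᵘ (suc d-1 · mkℚ +[1+ a ] d-1 coprime) ∎)
  where
  open ℚᵘ.≤-Reasoning
  1*d≤d*a*1 : + 1 ℤ.* + suc d-1 ℤ.≤ + (suc d-1 * suc a) ℤ.* + 1
  1*d≤d*a*1 = subst₂ ℤ._≤_ (sym (ℤ.*-identityˡ _)) (sym (ℤ.*-identityʳ _))
                     (ℤ.+≤+ (m≤m*n (suc d-1) (suc a)))

lastSatisfying : ∀ {P : ℕ → Set} → Decidable P → P 0 → ∀ m →
                 Σ[ q ∈ ℕ ] q ≤ m × P q × (q ≡ m ⊎ ¬ P (suc q))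
lastSatisfying P? P0 zero = 0 , z≤n , P0 , inj₁ refl
lastSatisfying P? P0 (suc m) with P? (suc m)
... | yes P[1+m] = suc m , ≤-refl , P[1+m] , inj₁ refl
... | no ¬P[1+m] with lastSatisfying P? P0 m
...   | q , q≤m , Pq , inj₁ refl       = q , m≤n⇒m≤1+n q≤m , Pq , inj₂ ¬P[1+m]
...   | q , q≤m , Pq , inj₂ ¬P[1+q] = q , m≤n⇒m≤1+n q≤m , Pq , inj₂ ¬P[1+q]

ℕtoℚ-nonNeg : ∀ n → 0ℚ ℚ.≤ ℕtoℚ n
ℕtoℚ-nonNeg n = ℚ.nonNegative⁻¹ (ℕtoℚ n) {{ℚ.normalize-nonNeg n 1}}

ℕtoℚ-mono-≤ : ∀ {m n} → m ≤ n → ℕtoℚ m ℚ.≤ ℕtoℚ n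
ℕtoℚ-mono-≤ {m} {n} m≤n = ℚ.toℚᵘ-cancel-≤ (begin
  toℚᵘ (ℕtoℚ m) ≃⟨ ℚ.toℚᵘ-fromℚᵘ (mkℚᵘ (+ m) 0) ⟩
  mkℚᵘ (+ m) 0  ≤⟨ *≤* (ℤ.*-monoʳ-≤-nonNeg (+ 1) (ℤ.+≤+ m≤n)) ⟩
  mkℚᵘ (+ n) 0  ≃⟨ ℚ.toℚᵘ-fromℚᵘ (mkℚᵘ (+ n) 0) ⟨
  toℚᵘ (ℕtoℚ n) ∎)
  where open ℚᵘ.≤-Reasoning

module _ (ε : ℚ) (m : ℕ) (1≤[1+m]ε : 1ℚ ℚ.≤ suc m · ε) where

  sandwichLevel : ∀ {V c} → c ≤ V → Σ[ q ∈ Fin (suc m) ] Sandwich (toℕ q · ε) ε c V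
  sandwichLevel {V} {c} c≤V =
    toFin (lastSatisfying (λ q → (q · ε) ℚ.* ℕtoℚ V ℚ.≤? ℕtoℚ c) 0-below m)
    where
    open ℚ.≤-Reasoning

    Below : ℕ → Set
    Below q = (q · ε) ℚ.* ℕtoℚ V ℚ.≤ ℕtoℚ c

    0-below : Below 0
    0-below = subst (ℚ._≤ ℕtoℚ c) (sym (ℚ.*-zeroˡ (ℕtoℚ V))) (ℕtoℚ-nonNeg c)

    upper : ∀ {q} → q ≡ m ⊎ ¬ Below (suc q) → ℕtoℚ c ℚ.≤ (suc q · ε) ℚ.* ℕtoℚ V
    upper (inj₂ ¬below) = ℚ.<⇒≤ (ℚ.≰⇒> ¬below)
    upper (inj₁ refl)   = begin
      ℕtoℚ c                 ≤⟨ ℕtoℚ-mono-≤ c≤V ⟩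
      ℕtoℚ V                 ≡⟨ ℚ.*-identityˡ (ℕtoℚ V) ⟨
      1ℚ ℚ.* ℕtoℚ V          ≤⟨ ℚ.*-monoʳ-≤-nonNeg (ℕtoℚ V) {{ℚ.normalize-nonNeg V 1}} 1≤[1+m]ε ⟩
      (suc m · ε) ℚ.* ℕtoℚ V ∎

    toFin : Σ[ q ∈ ℕ ] q ≤ m × Below q × (q ≡ m ⊎ ¬ Below (suc q)) →
            Σ[ q ∈ Fin (suc m) ] Sandwich (toℕ q · ε) ε c V
    toFin (q , q≤m , lower , last) =
      fromℕ< (s≤s q≤m) ,
      subst (λ x → Sandwich (x · ε) ε c V) (sym (toℕ-fromℕ< (s≤s q≤m)))
        (lower , subst (λ x → ℕtoℚ c ℚ.≤ x ℚ.* ℕtoℚ V) (ℚ.+-comm ε (q · ε)) (upper last))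

countFin≤ : ∀ n {P : Fin n → Set} (P? : Decidable P) → countFin n P? ≤ n
countFin≤ zero    P? = z≤n
countFin≤ (suc n) P? with P? zero
... | yes _ = s≤s (countFin≤ n (P? ∘ suc))
... | no  _ = m≤n⇒m≤1+n (countFin≤ n (P? ∘ suc))

module _ {N : ℕ} (H : PHG N) (ε : ℚ) (x y z : Fin N) where

  sideSize : Fin 3 → ℕ
  sideSize zero             = size H x y
  sideSize (suc zero)       = size H x z
  sideSize (suc (suc zero)) = size H y z

  sideHigh : Fin 3 → ℕ
  sideHigh zero             = highij H x y z ε
  sideHigh (suc zero)       = highik H x y z ε
  sideHigh (suc (suc zero)) = highjk H x y z ε

  sideHigh≤sideSize : ∀ side → sideHigh side ≤ sideSize side
  sideHigh≤sideSize zero             = countFin≤ _ _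
  sideHigh≤sideSize (suc zero)       = countFin≤ _ _
  sideHigh≤sideSize (suc (suc zero)) = countFin≤ _ _

AllPairs<-triple : ∀ {n} {i j k : Fin n} → i < j → j < k → AllPairs _<_ (i ∷ j ∷ k ∷ [])
AllPairs<-triple i<j j<k = (i<j ∷ Fin.<-trans i<j j<k ∷ []) ∷ (j<k ∷ []) ∷ [] ∷ []

LevelledInducedSubhypergraph : ∀ {N} → ℚ → ℕ → PHG N → Set
LevelledInducedSubhypergraph {N} ε n H =
  Σ (Fin n → Fin N) λ a → StrictlyIncreasing a ×
  Σ ℚ λ ℓ → Σ ℚ λ t → Σ ℚ λ r →
  (i j k : Fin n) → i < j → j < k →
    let H' = induced H a in
    Sandwich ℓ ε (highij H' i j k ε) (size H' i j) ×
    Sandwich t ε (highik H' i j k ε) (size H' i k) ×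
    Sandwich r ε (highjk H' i j k ε) (size H' j k)

-- The levels are a variable so that no two Sandwich types with syntactically different levels
-- meet: Agda would compare them by normalising the rational arithmetic, which is very slow.
sandwiched⇒levelled : ∀ {n N} (H : PHG N) (ε : ℚ) (b : Fin n → Fin N) → StrictlyIncreasing b →
  (level : Fin 3 → ℚ) →
  (∀ {i j k} → i < j → j < k → ∀ side →
     Sandwich (level side) ε
              (sideHigh H ε (b i) (b j) (b k) side) (sideSize H ε (b i) (b j) (b k) side)) →
  LevelledInducedSubhypergraph ε n H
sandwiched⇒levelled H ε b b↑ level sandwiched =
  b , b↑ , level zero , level (suc zero) , level (suc (suc zero)) , λ i j k i<j j<k →
  sandwiched i<j j<k zero , sandwiched i<j j<k (suc zero) , sandwiched i<j j<k (suc (suc zero))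

module _ (ε : ℚ) (m : ℕ) (1≤[1+m]ε : 1ℚ ℚ.≤ suc m · ε) where

  module _ {N : ℕ} (H : PHG N) where

    sideLevel : ∀ {x y z} side →
                Σ[ q ∈ Fin (suc m) ] Sandwich (toℕ q · ε) ε
                                              (sideHigh H ε x y z side) (sideSize H ε x y z side)
    sideLevel {x} {y} {z} side = sandwichLevel ε m 1≤[1+m]ε (sideHigh≤sideSize H ε x y z side)

    triadColour : Vec (Fin N) 3 → Fin (suc m ^ 3)
    triadColour (x ∷ y ∷ z ∷ []) = funToFin (λ side → proj₁ (sideLevel {x} {y} {z} side))

    triadColour-sandwich : ∀ {x y z col} → triadColour (x ∷ y ∷ z ∷ []) ≡ col → ∀ side →
      Sandwich (toℕ (finToFun col side) · ε) ε (sideHigh H ε x y z side) (sideSize H ε x y z side)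
    triadColour-sandwich {x} {y} {z} {col} colour≡col side =
      subst (λ q → Sandwich (toℕ q · ε) ε (sideHigh H ε x y z side) (sideSize H ε x y z side))
        (trans (sym (finToFun-funToFin (λ side → proj₁ (sideLevel {x} {y} {z} side)) side))
               (cong (λ c → finToFun c side) colour≡col))
        (proj₂ (sideLevel side))

    homogeneous⇒sandwiched : ∀ {n} {b : Fin n → Fin N} {col} → Homogeneous triadColour b col →
      ∀ {i j k} → i < j → j < k → ∀ side →
      Sandwich (toℕ (finToFun col side) · ε) ε
               (sideHigh H ε (b i) (b j) (b k) side) (sideSize H ε (b i) (b j) (b k) side)
    homogeneous⇒sandwiched {b = b} {col} hom {i} {j} {k} i<j j<k =
      triadColour-sandwich {b i} {b j} {b k} {col} (hom (i ∷ j ∷ k ∷ []) (AllPairs<-triple i<j j<k))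

    homogeneous⇒levelled : ∀ {n} → HomogeneousSet triadColour n → LevelledInducedSubhypergraph ε n H
    homogeneous⇒levelled (b , b↑ , col , hom) =
      sandwiched⇒levelled H ε b b↑ (λ side → toℕ (finToFun col side) · ε) (homogeneous⇒sandwiched hom)

  levelledSubhypergraph : ∀ n → Σ ℕ λ N → (H : PHG N) → LevelledInducedSubhypergraph ε n H
  levelledSubhypergraph n =
    ramseyNumber 3 (suc m ^ 3) n , λ H → homogeneous⇒levelled H (ramsey 3 (suc m ^ 3) n (triadColour H))

lemma3p1 : (ε : ℚ) → 0ℚ <ℚ ε → (n : ℕ) →
    Σ ℕ λ N → (H : PHG N) →
    Σ (Fin n → Fin N) λ a → StrictlyIncreasing a ×
    Σ ℚ λ ℓ → Σ ℚ λ t → Σ ℚ λ r →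
    (i j k : Fin n) → i < j → j < k →
      let H' = induced H a in
      Sandwich ℓ ε (highij H' i j k ε) (size H' i j) ×
      Sandwich t ε (highik H' i j k ε) (size H' i k) ×
      Sandwich r ε (highjk H' i j k ε) (size H' j k)
lemma3p1 ε ε>0 n = let m , 1≤[1+m]ε = archimedean ε ε>0 in levelledSubhypergraph ε m 1≤[1+m]ε n
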